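{- Let $n\ge1$. For $0\le k\le n-1$, let $A_{n,k}$ be the set of pairs of nonnegative integers $(i,j)$ with $$i\geq \frac{k(k+1)}{2},\qquad j\geq \frac{(n-k-1)(n-k)}{2},\qquad i+j\leq \frac{n(n-1)}{2},$$ and let $A_n=\bigcup_{k=0}^{n-1}A_{n,k}$. Then there exists a Gog triangle of size $n$ with exactly $i$ inversions and exactly $j$ coinversions if and only if $(i,j)\in A_n$. Moreover, if $i=\frac{k(k+1)}{2}$ and $j=\frac{(n-k-1)(n-k)}{2}$ for some $k\in\{0,\dots,n-1\}$, then there is a unique Gog triangle of size $n$ with $i$ inversions and $j$ coinversions, and its bottom entry $X_{1,1}$ equals $n-k$.
   Context: A Gog triangle of size $n$ is an array $X=(X_{i,j})_{n\ge i\ge j\ge 1}$ of positive integers with $X_{i+1,j}\le X_{i,j}\le X_{i+1,j+1}$ for $n-1\ge i\ge j\ge1$, strictly increasing rows ($X_{i,j}<X_{i,j+1}$), and top row $X_{n,j}=j$ for $1\le j\le n$. The bottom entry is $X_{1,1}$. An inversion of $X$ is a pair $(i,j)$ with $X_{i,j}=X_{i+1,j}$. A coinversion is a pair $(i,j)$ with $X_{i,j}=X_{i+1,j+1}$. -}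

module Defs where

open import Data.Nat using (ℕ; zero; suc; _+_; _*_; _∸_; _≤_; _<_; _/_)
open import Data.Nat.Properties using (_≟_)
open import Data.Product using (_×_; ∃-syntax)
open import Relation.Nullary.Decidable using (⌊_⌋)
open import Data.Bool using (if_then_else_)
open import Relation.Binary.PropositionalEquality using (_≡_)

-- An array indexed by (i , j); only the entries with n ≥ i ≥ j ≥ 1 matter.
Array : Set
Array = ℕ → ℕ → ℕ

record IsGog (n : ℕ) (X : Array) : Set where
  field
    top       : ∀ j → 1 ≤ j → j ≤ n → X n j ≡ j
    positive  : ∀ i j → 1 ≤ j → j ≤ i → i ≤ n → 1 ≤ X i j
    rowStrict : ∀ i j → 1 ≤ j → j < i → i ≤ n → X i j < X i (suc j)
    interlL   : ∀ i j → 1 ≤ j → j ≤ i → i < n → X (suc i) j ≤ X i j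
    interlR   : ∀ i j → 1 ≤ j → j ≤ i → i < n → X i j ≤ X (suc i) (suc j)

Σ₁ : ℕ → (ℕ → ℕ) → ℕ
Σ₁ zero    f = 0
Σ₁ (suc m) f = Σ₁ m f + f (suc m)

δ : ℕ → ℕ → ℕ
δ a b = if ⌊ a ≟ b ⌋ then 1 else 0

inversions : ℕ → Array → ℕ
inversions n X = Σ₁ (n ∸ 1) (λ i → Σ₁ i (λ j → δ (X i j) (X (suc i) j)))

coinversions : ℕ → Array → ℕ
coinversions n X = Σ₁ (n ∸ 1) (λ i → Σ₁ i (λ j → δ (X i j) (X (suc i) (suc j))))

InA-k : ℕ → ℕ → ℕ → ℕ → Set
InA-k n k i j =
  (k * suc k) / 2 ≤ i × ((n ∸ k ∸ 1) * (n ∸ k)) / 2 ≤ j × i + j ≤ (n * (n ∸ 1)) / 2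

InA : ℕ → ℕ → ℕ → Set
InA n i j = ∃[ k ] (k < n × InA-k n k i j)

SameTriangle : ℕ → Array → Array → Set
SameTriangle n X Y = ∀ i j → 1 ≤ j → j ≤ i → i ≤ n → X i j ≡ Y i j

module Submission where

-- Write T k = 1 + ⋯ + k = k(k+1)/2. Everything rests on two ways of shrinking a Gog
-- triangle X by one: deleting its first column (and subtracting 1 from the rest), or
-- deleting its main diagonal. Both minors are Gog triangles, and the counts of X split
-- into those of the minor plus those located in the deleted column or diagonal.
-- Telescoping along that column/diagonal relates the latter to the bottom entry X 1 1.
--  * Upper bound: a first-column entry is an inversion or a coinversion, never both,
--    so inversions + coinversions ≤ T m.
--  * Lower bound: for every k, inversions ≥ T (k+1) or coinversions ≥ T (m−k); hence
--    every triangle lies weakly above some corner (T k, T (m−k)).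
--  * Corners: an explicit triangle E n k attains (T k, T (m−k)); any triangle there has
--    bottom entry n − k and both minors at corners, so it is E n k by induction.
--  * Existence: by induction on the size, glue a column of ones (m more inversions) or
--    a constant top diagonal (m more coinversions) onto a smaller triangle; the points
--    out of reach of both are realised by an explicit "frame" triangle.

open import Defs
open import Data.Nat
open import Data.Nat.Properties
open import Data.Nat.DivMod using (m*n/n≡m)
open import Data.Nat.Tactic.RingSolver using (solve-∀)
open import Algebra.Properties.CommutativeSemigroup +-commutativeSemigroup
  using (interchange; xy∙z≈xz∙y; x∙yz≈xz∙y)
open import Data.Product using (_×_; _,_; proj₁; proj₂; ∃-syntax)
open import Data.Sum using (_⊎_; inj₁; inj₂)
open import Data.Empty using (⊥; ⊥-elim)
open import Function.Bundles using (_⇔_; mk⇔)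
open import Relation.Binary.PropositionalEquality
open import Relation.Nullary using (yes; no)
open import Relation.Binary.Definitions using (tri<; tri≈; tri>)

open IsGog

δ-refl : ∀ a → δ a a ≡ 1
δ-refl a with a ≟ a
... | yes _   = refl
... | no a≢a = ⊥-elim (a≢a refl)

δ-≢ : ∀ {a b} → a ≢ b → δ a b ≡ 0
δ-≢ {a} {b} a≢b with a ≟ b
... | yes a≡b = ⊥-elim (a≢b a≡b)
... | no _    = refl

δ-comm : ∀ a b → δ a b ≡ δ b a
δ-comm a b with a ≟ b
... | yes refl = sym (δ-refl a)
... | no a≢b   = sym (δ-≢ (≢-sym a≢b))

δ-suc : ∀ a b → δ (suc a) (suc b) ≡ δ a b
δ-suc a b with a ≟ b
... | yes refl = δ-refl (suc a)
... | no a≢b   = δ-≢ (λ e → a≢b (suc-injective e))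

δ-pair≤1 : ∀ a {b c} → b < c → δ a b + δ a c ≤ 1
δ-pair≤1 a {b} {c} b<c with a ≟ b
... | yes refl = ≤-reflexive (cong suc (δ-≢ (<⇒≢ b<c)))
... | no _     = δ≤1
  where
  δ≤1 : δ a c ≤ 1
  δ≤1 with a ≟ c
  ... | yes _ = ≤-refl
  ... | no _  = z≤n

-- If b ≤ a then either a = b or a ≥ b + 1; in both cases b + 1 ≤ a + δ a b.
δ-gap : ∀ {a b} → b ≤ a → b + 1 ≤ a + δ a b
δ-gap {a} {b} b≤a with a ≟ b
... | yes refl = ≤-refl
... | no a≢b   = begin
    b + 1  ≡⟨ +-comm b 1 ⟩
    suc b  ≤⟨ ≤∧≢⇒< b≤a (≢-sym a≢b) ⟩
    a      ≡⟨ sym (+-identityʳ a) ⟩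
    a + 0  ∎
  where open ≤-Reasoning

Step : ℕ → ℕ → Set
Step a b = b ≤ a × a ≤ suc b

step-δ : ∀ {a b} → Step a b → b + 1 ≡ a + δ a b
step-δ {a} {b} (b≤a , a≤1+b) with a ≟ b
... | yes refl = refl
... | no a≢b   = trans (+-comm b 1)
    (sym (trans (+-identityʳ a) (≤-antisym a≤1+b (≤∧≢⇒< b≤a (≢-sym a≢b)))))

Σ₁-cong : ∀ m f g → (∀ i → 1 ≤ i → i ≤ m → f i ≡ g i) → Σ₁ m f ≡ Σ₁ m g
Σ₁-cong zero    f g f≡g = refl
Σ₁-cong (suc m) f g f≡g =
  cong₂ _+_ (Σ₁-cong m f g (λ i p q → f≡g i p (m≤n⇒m≤1+n q))) (f≡g (suc m) (s≤s z≤n) ≤-refl)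

Σ₁-mono : ∀ m f g → (∀ i → 1 ≤ i → i ≤ m → f i ≤ g i) → Σ₁ m f ≤ Σ₁ m g
Σ₁-mono zero    f g f≤g = z≤n
Σ₁-mono (suc m) f g f≤g =
  +-mono-≤ (Σ₁-mono m f g (λ i p q → f≤g i p (m≤n⇒m≤1+n q))) (f≤g (suc m) (s≤s z≤n) ≤-refl)

Σ₁-first : ∀ m f → Σ₁ (suc m) f ≡ f 1 + Σ₁ m (λ i → f (suc i))
Σ₁-first zero    f = +-comm 0 (f 1)
Σ₁-first (suc m) f =
  trans (cong (_+ f (suc (suc m))) (Σ₁-first m f)) (+-assoc (f 1) _ _)

Σ₁-+ : ∀ m f g → Σ₁ m (λ i → f i + g i) ≡ Σ₁ m f + Σ₁ m g
Σ₁-+ zero    f g = refl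
Σ₁-+ (suc m) f g = trans (cong (_+ (f (suc m) + g (suc m))) (Σ₁-+ m f g))
                         (interchange (Σ₁ m f) (Σ₁ m g) (f (suc m)) (g (suc m)))

Σ₁-const : ∀ m f c → (∀ i → 1 ≤ i → i ≤ m → f i ≡ c) → Σ₁ m f ≡ m * c
Σ₁-const zero    f c f≡c = refl
Σ₁-const (suc m) f c f≡c = trans
  (cong₂ _+_ (Σ₁-const m f c (λ i p q → f≡c i p (m≤n⇒m≤1+n q))) (f≡c (suc m) (s≤s z≤n) ≤-refl))
  (+-comm (m * c) c)

Σ₁-zero : ∀ m f → (∀ i → 1 ≤ i → i ≤ m → f i ≡ 0) → Σ₁ m f ≡ 0
Σ₁-zero m f f≡0 = trans (Σ₁-const m f 0 f≡0) (*-zeroʳ m)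

Σ₁-one : ∀ m f → (∀ i → 1 ≤ i → i ≤ m → f i ≡ 1) → Σ₁ m f ≡ m
Σ₁-one m f f≡1 = trans (Σ₁-const m f 1 f≡1) (*-identityʳ m)

-- Telescoping along a path p 1, p 2, …, p (L+1): local inequalities between the
-- step costs a and b sum up, with only the endpoints of p surviving.
telescope↓ : ∀ L (p a b : ℕ → ℕ) → (∀ i → 1 ≤ i → i ≤ L → p (suc i) + a i ≤ p i + b i) →
             Σ₁ L a + p (suc L) ≤ Σ₁ L b + p 1
telescope↓ zero    p a b step = ≤-refl
telescope↓ (suc L) p a b step = begin
    Σ₁ L a + a (suc L) + p (suc (suc L))   ≡⟨ xy∙z≈xz∙y (Σ₁ L a) _ _ ⟩
    Σ₁ L a + p (suc (suc L)) + a (suc L)   ≡⟨ +-assoc (Σ₁ L a) _ _ ⟩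
    Σ₁ L a + (p (suc (suc L)) + a (suc L)) ≤⟨ +-monoʳ-≤ (Σ₁ L a) (step (suc L) (s≤s z≤n) ≤-refl) ⟩
    Σ₁ L a + (p (suc L) + b (suc L))       ≡⟨ +-assoc (Σ₁ L a) _ _ ⟨
    Σ₁ L a + p (suc L) + b (suc L)         ≤⟨ +-monoˡ-≤ (b (suc L)) earlier ⟩
    Σ₁ L b + p 1 + b (suc L)               ≡⟨ xy∙z≈xz∙y (Σ₁ L b) _ _ ⟩
    Σ₁ L b + b (suc L) + p 1               ∎
  where
  open ≤-Reasoning
  earlier = telescope↓ L p a b (λ i q r → step i q (m≤n⇒m≤1+n r))

telescope↑ : ∀ L (p a b : ℕ → ℕ) → (∀ i → 1 ≤ i → i ≤ L → p i + a i ≤ p (suc i) + b i) →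
             Σ₁ L a + p 1 ≤ Σ₁ L b + p (suc L)
telescope↑ zero    p a b step = ≤-refl
telescope↑ (suc L) p a b step = begin
    Σ₁ L a + a (suc L) + p 1               ≡⟨ xy∙z≈xz∙y (Σ₁ L a) _ _ ⟩
    Σ₁ L a + p 1 + a (suc L)               ≤⟨ +-monoˡ-≤ (a (suc L)) earlier ⟩
    Σ₁ L b + p (suc L) + a (suc L)         ≡⟨ +-assoc (Σ₁ L b) _ _ ⟩
    Σ₁ L b + (p (suc L) + a (suc L))       ≤⟨ +-monoʳ-≤ (Σ₁ L b) (step (suc L) (s≤s z≤n) ≤-refl) ⟩
    Σ₁ L b + (p (suc (suc L)) + b (suc L)) ≡⟨ x∙yz≈xz∙y (Σ₁ L b) _ _ ⟩
    Σ₁ L b + b (suc L) + p (suc (suc L))   ∎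
  where
  open ≤-Reasoning
  earlier = telescope↑ L p a b (λ i q r → step i q (m≤n⇒m≤1+n r))

Σ₁-ones : ∀ L → Σ₁ L (λ _ → 1) ≡ L
Σ₁-ones L = Σ₁-one L _ (λ _ _ _ → refl)

flats : ℕ → (ℕ → ℕ) → ℕ
flats L u = Σ₁ L (λ i → δ (u i) (u (suc i)))

descentFlats : ∀ L u → (∀ i → 1 ≤ i → i ≤ L → Step (u i) (u (suc i))) →
               L + u (suc L) ≡ flats L u + u 1
descentFlats L u steps = ≤-antisym
  (subst (λ s → s + u (suc L) ≤ flats L u + u 1) (Σ₁-ones L)
    (telescope↓ L u (λ _ → 1) _ (λ i p q → ≤-reflexive (step-δ (steps i p q)))))
  (subst (λ s → flats L u + u 1 ≤ s + u (suc L)) (Σ₁-ones L)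
    (telescope↑ L u _ (λ _ → 1) (λ i p q → ≤-reflexive (sym (step-δ (steps i p q))))))

ascentFlats : ∀ L u → (∀ i → 1 ≤ i → i ≤ L → Step (u (suc i)) (u i)) →
              L + u 1 ≡ flats L u + u (suc L)
ascentFlats L u steps = ≤-antisym
  (subst (λ s → s + u 1 ≤ flats L u + u (suc L)) (Σ₁-ones L)
    (telescope↑ L u (λ _ → 1) _ (λ i p q → ≤-reflexive (step-δ′ i p q))))
  (subst (λ s → flats L u + u (suc L) ≤ s + u 1) (Σ₁-ones L)
    (telescope↓ L u _ (λ _ → 1) (λ i p q → ≤-reflexive (sym (step-δ′ i p q)))))
  where
  step-δ′ : ∀ i → 1 ≤ i → i ≤ L → u i + 1 ≡ u (suc i) + δ (u i) (u (suc i))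
  step-δ′ i p q = trans (step-δ (steps i p q)) (cong (u (suc i) +_) (δ-comm (u (suc i)) (u i)))

ΣΣ : ℕ → (ℕ → ℕ → ℕ) → ℕ
ΣΣ m g = Σ₁ m (λ i → Σ₁ i (g i))

ΣΣ-cong : ∀ m g h → (∀ i j → 1 ≤ j → j ≤ i → i ≤ m → g i j ≡ h i j) → ΣΣ m g ≡ ΣΣ m h
ΣΣ-cong m g h g≡h = Σ₁-cong m _ _ (λ i p q → Σ₁-cong i _ _ (λ j p′ q′ → g≡h i j p′ q′ q))

ΣΣ-peelColumn : ∀ m g → ΣΣ (suc m) g ≡ ΣΣ m (λ i j → g (suc i) (suc j)) + Σ₁ (suc m) (λ i → g i 1)
ΣΣ-peelColumn m g = begin
    Σ₁ (suc m) (λ i → Σ₁ i (g i))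
  ≡⟨ Σ₁-cong (suc m) _ _ splitRow ⟩
    Σ₁ (suc m) (λ i → g i 1 + Σ₁ (pred i) (λ j → g i (suc j)))
  ≡⟨ Σ₁-+ (suc m) _ _ ⟩
    Σ₁ (suc m) (λ i → g i 1) + Σ₁ (suc m) (λ i → Σ₁ (pred i) (λ j → g i (suc j)))
  ≡⟨ +-comm (Σ₁ (suc m) (λ i → g i 1)) _ ⟩
    Σ₁ (suc m) (λ i → Σ₁ (pred i) (λ j → g i (suc j))) + Σ₁ (suc m) (λ i → g i 1)
  ≡⟨ cong (_+ Σ₁ (suc m) (λ i → g i 1)) (Σ₁-first m _) ⟩
    ΣΣ m (λ i j → g (suc i) (suc j)) + Σ₁ (suc m) (λ i → g i 1) ∎
  where
  open ≡-Reasoning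
  splitRow : ∀ i → 1 ≤ i → i ≤ suc m → Σ₁ i (g i) ≡ g i 1 + Σ₁ (pred i) (λ j → g i (suc j))
  splitRow (suc i) _ _ = Σ₁-first i (g (suc i))

ΣΣ-peelDiagonal : ∀ m g → ΣΣ (suc m) g ≡ ΣΣ m (λ i j → g (suc i) j) + Σ₁ (suc m) (λ i → g i i)
ΣΣ-peelDiagonal m g = begin
    Σ₁ (suc m) (λ i → Σ₁ i (g i))
  ≡⟨ Σ₁-cong (suc m) _ _ splitRow ⟩
    Σ₁ (suc m) (λ i → Σ₁ (pred i) (g i) + g i i)
  ≡⟨ Σ₁-+ (suc m) _ _ ⟩
    Σ₁ (suc m) (λ i → Σ₁ (pred i) (g i)) + Σ₁ (suc m) (λ i → g i i)
  ≡⟨ cong (_+ Σ₁ (suc m) (λ i → g i i)) (Σ₁-first m _) ⟩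
    ΣΣ m (λ i j → g (suc i) j) + Σ₁ (suc m) (λ i → g i i) ∎
  where
  open ≡-Reasoning
  splitRow : ∀ i → 1 ≤ i → i ≤ suc m → Σ₁ i (g i) ≡ Σ₁ (pred i) (g i) + g i i
  splitRow (suc i) _ _ = refl

dropColumn : Array → Array
dropColumn X i j = X (suc i) (suc j)

dropDiagonal : Array → Array
dropDiagonal X i j = X (suc i) j

colInv colCoinv diagInv diagCoinv : ℕ → Array → ℕ
colInv    n X = Σ₁ n (λ i → δ (X i 1) (X (suc i) 1))
colCoinv  n X = Σ₁ n (λ i → δ (X i 1) (X (suc i) 2))
diagInv   n X = Σ₁ n (λ i → δ (X i i) (X (suc i) i))
diagCoinv n X = Σ₁ n (λ i → δ (X i i) (X (suc i) (suc i)))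

inv-peelColumn : ∀ n X → inversions (suc n) X ≡ inversions n (dropColumn X) + colInv n X
inv-peelColumn zero    X = refl
inv-peelColumn (suc m) X = ΣΣ-peelColumn m _

coinv-peelColumn : ∀ n X → coinversions (suc n) X ≡ coinversions n (dropColumn X) + colCoinv n X
coinv-peelColumn zero    X = refl
coinv-peelColumn (suc m) X = ΣΣ-peelColumn m _

inv-peelDiagonal : ∀ n X → inversions (suc n) X ≡ inversions n (dropDiagonal X) + diagInv n X
inv-peelDiagonal zero    X = refl
inv-peelDiagonal (suc m) X = ΣΣ-peelDiagonal m _

coinv-peelDiagonal : ∀ n X → coinversions (suc n) X ≡ coinversions n (dropDiagonal X) + diagCoinv n X
coinv-peelDiagonal zero    X = refl
coinv-peelDiagonal (suc m) X = ΣΣ-peelDiagonal m _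

inv-cong : ∀ n X Y → SameTriangle n X Y → inversions n X ≡ inversions n Y
inv-cong zero    X Y X≡Y = refl
inv-cong (suc m) X Y X≡Y = ΣΣ-cong m _ _ (λ i j p q r →
  cong₂ δ (X≡Y i j p q (m≤n⇒m≤1+n r)) (X≡Y (suc i) j p (m≤n⇒m≤1+n q) (s≤s r)))

coinv-cong : ∀ n X Y → SameTriangle n X Y → coinversions n X ≡ coinversions n Y
coinv-cong zero    X Y X≡Y = refl
coinv-cong (suc m) X Y X≡Y = ΣΣ-cong m _ _ (λ i j p q r →
  cong₂ δ (X≡Y i j p q (m≤n⇒m≤1+n r)) (X≡Y (suc i) (suc j) (s≤s z≤n) (s≤s q) (s≤s r)))

inv-suc : ∀ n X → inversions n (λ i j → suc (X i j)) ≡ inversions n X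
inv-suc zero    X = refl
inv-suc (suc m) X = ΣΣ-cong m _ _ (λ i j _ _ _ → δ-suc _ _)

coinv-suc : ∀ n X → coinversions n (λ i j → suc (X i j)) ≡ coinversions n X
coinv-suc zero    X = refl
coinv-suc (suc m) X = ΣΣ-cong m _ _ (λ i j _ _ _ → δ-suc _ _)

-- Rows strictly increase from a positive first entry, so X i j ≥ j.
entry≥column : ∀ {n X} → IsGog n X → ∀ i j → 1 ≤ j → j ≤ i → i ≤ n → j ≤ X i j
entry≥column G i (suc zero)    _ q r = positive G i 1 ≤-refl q r
entry≥column G i (suc (suc j)) _ q r =
  ≤-trans (s≤s (entry≥column G i (suc j) (s≤s z≤n) (≤-trans (n≤1+n _) q) r))
          (rowStrict G i (suc j) (s≤s z≤n) q r)

columnMinor : Array → Array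
columnMinor X i j = X (suc i) (suc j) ∸ 1

columnMinor-isGog : ∀ {m X} → IsGog (suc m) X → IsGog m (columnMinor X)
columnMinor-isGog G = record
  { top       = λ j p q → cong (_∸ 1) (top G (suc j) (s≤s z≤n) (s≤s q))
  ; positive  = λ i j p q r →
      ≤-trans p (∸-monoˡ-≤ 1 (entry≥column G (suc i) (suc j) (s≤s z≤n) (s≤s q) (s≤s r)))
  ; rowStrict = λ i j p q r →
      ∸-monoˡ-< (rowStrict G (suc i) (suc j) (s≤s z≤n) (s≤s q) (s≤s r))
                (positive G (suc i) (suc j) (s≤s z≤n) (≤-trans (n≤1+n _) (s≤s q)) (s≤s r))
  ; interlL   = λ i j p q r → ∸-monoˡ-≤ 1 (interlL G (suc i) (suc j) (s≤s z≤n) (s≤s q) (s≤s r))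
  ; interlR   = λ i j p q r → ∸-monoˡ-≤ 1 (interlR G (suc i) (suc j) (s≤s z≤n) (s≤s q) (s≤s r))
  }

dropDiagonal-isGog : ∀ {m X} → IsGog (suc m) X → IsGog m (dropDiagonal X)
dropDiagonal-isGog {m} G = record
  { top       = λ j p q → top G j p (m≤n⇒m≤1+n q)
  ; positive  = λ i j p q r → positive G (suc i) j p (m≤n⇒m≤1+n q) (s≤s r)
  ; rowStrict = λ i j p q r → rowStrict G (suc i) j p (m≤n⇒m≤1+n q) (s≤s r)
  ; interlL   = λ i j p q r → interlL G (suc i) j p (m≤n⇒m≤1+n q) (s≤s r)
  ; interlR   = λ i j p q r → interlR G (suc i) j p (m≤n⇒m≤1+n q) (s≤s r)
  }

dropColumn-as-minor : ∀ {n X} → IsGog (suc n) X →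
  SameTriangle n (dropColumn X) (λ i j → suc (columnMinor X i j))
dropColumn-as-minor G i j p q r =
  sym (m+[n∸m]≡n (positive G (suc i) (suc j) (s≤s z≤n) (s≤s q) (s≤s r)))

inv-peelColumnMinor : ∀ {n X} → IsGog (suc n) X →
  inversions (suc n) X ≡ inversions n (columnMinor X) + colInv n X
inv-peelColumnMinor {n} {X} G = trans (inv-peelColumn n X) (cong (_+ colInv n X)
  (trans (inv-cong n _ _ (dropColumn-as-minor G)) (inv-suc n (columnMinor X))))

coinv-peelColumnMinor : ∀ {n X} → IsGog (suc n) X →
  coinversions (suc n) X ≡ coinversions n (columnMinor X) + colCoinv n X
coinv-peelColumnMinor {n} {X} G = trans (coinv-peelColumn n X) (cong (_+ colCoinv n X)
  (trans (coinv-cong n _ _ (dropColumn-as-minor G)) (coinv-suc n (columnMinor X))))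

column-mono : ∀ {n X} → IsGog n X → ∀ i d → 1 ≤ i → i + d ≤ n → X (i + d) 1 ≤ X i 1
column-mono G i zero    p q rewrite +-identityʳ i = ≤-refl
column-mono G i (suc d) p q rewrite +-suc i d =
  ≤-trans (interlL G (i + d) 1 ≤-refl (≤-trans p (m≤m+n i d)) q)
          (column-mono G i d p (<⇒≤ q))

diagonal-mono : ∀ {n X} → IsGog n X → ∀ i d → 1 ≤ i → i + d ≤ n → X i i ≤ X (i + d) (i + d)
diagonal-mono G i zero    p q rewrite +-identityʳ i = ≤-refl
diagonal-mono G i (suc d) p q rewrite +-suc i d =
  ≤-trans (diagonal-mono G i d p (<⇒≤ q))
          (interlR G (i + d) (i + d) (≤-trans p (m≤m+n i d)) ≤-refl q)

-- Diagonal entries are at most the size, the top-right entry.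
diagonal≤size : ∀ {n X} → IsGog n X → ∀ i → 1 ≤ i → i ≤ n → X i i ≤ n
diagonal≤size {n} {X} G i p q = begin
  X i i                      ≤⟨ diagonal-mono G i (n ∸ i) p (≤-reflexive (m+[n∸m]≡n q)) ⟩
  X (i + (n ∸ i)) (i + (n ∸ i)) ≡⟨ cong (λ k → X k k) (m+[n∸m]≡n q) ⟩
  X n n                      ≡⟨ top G n (≤-trans p q) ≤-refl ⟩
  n                          ∎
  where open ≤-Reasoning

-- The first column climbs from X (m+1) 1 = 1 to X 1 1, rising by at least one at
-- every step that is not an inversion.
columnBound : ∀ {m X} → IsGog (suc m) X → suc m ≤ colInv m X + X 1 1
columnBound {m} {X} G =
  subst (_≤ colInv m X + X 1 1) (trans (cong₂ _+_ (Σ₁-ones m) (top G 1 ≤-refl (s≤s z≤n))) (+-comm m 1))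
    (telescope↓ m (λ i → X i 1) (λ _ → 1) _
      (λ i p q → δ-gap (interlL G i 1 ≤-refl p (s≤s q))))

-- The diagonal climbs from X 1 1 to X (m+1) (m+1) = m+1, rising by at least one at
-- every step that is not a coinversion.
diagonalBound : ∀ {m X} → IsGog (suc m) X → X 1 1 ≤ diagCoinv m X + 1
diagonalBound {m} {X} G = +-cancelˡ-≤ m (X 1 1) (diagCoinv m X + 1) (begin
    m + X 1 1                             ≡⟨ cong (_+ X 1 1) (Σ₁-ones m) ⟨
    Σ₁ m (λ _ → 1) + X 1 1                ≤⟨ telescope↑ m (λ i → X i i) (λ _ → 1) _ step ⟩
    diagCoinv m X + X (suc m) (suc m)     ≡⟨ cong (diagCoinv m X +_) (top G (suc m) (s≤s z≤n) ≤-refl) ⟩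
    diagCoinv m X + suc m                 ≡⟨ rearrange (diagCoinv m X) m ⟩
    m + (diagCoinv m X + 1)               ∎)
  where
  open ≤-Reasoning
  rearrange : ∀ c m → c + suc m ≡ m + (c + 1)
  rearrange = solve-∀
  step : ∀ i → 1 ≤ i → i ≤ m → X i i + 1 ≤ X (suc i) (suc i) + δ (X i i) (X (suc i) (suc i))
  step i p q = subst (λ d → X i i + 1 ≤ X (suc i) (suc i) + d) (δ-comm _ _)
                 (δ-gap (interlR G i i p ≤-refl (s≤s q)))

columnPeel : ∀ {n X} → IsGog (suc n) X →
  inversions n (columnMinor X) + suc n ≤ inversions (suc n) X + X 1 1 ×
  coinversions n (columnMinor X) ≤ coinversions (suc n) X
columnPeel {n} {X} G =
  (begin
    inversions n (columnMinor X) + suc n                   ≤⟨ +-monoʳ-≤ _ (columnBound G) ⟩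
    inversions n (columnMinor X) + (colInv n X + X 1 1)    ≡⟨ +-assoc (inversions n (columnMinor X)) _ _ ⟨
    inversions n (columnMinor X) + colInv n X + X 1 1      ≡⟨ cong (_+ X 1 1) (inv-peelColumnMinor G) ⟨
    inversions (suc n) X + X 1 1                           ∎) ,
  ≤-trans (m≤m+n _ _) (≤-reflexive (sym (coinv-peelColumnMinor G)))
  where open ≤-Reasoning

diagonalPeel : ∀ {n X} → IsGog (suc n) X →
  inversions n (dropDiagonal X) ≤ inversions (suc n) X ×
  coinversions n (dropDiagonal X) + X 1 1 ≤ coinversions (suc n) X + 1
diagonalPeel {n} {X} G =
  ≤-trans (m≤m+n _ _) (≤-reflexive (sym (inv-peelDiagonal n X))) ,
  (begin
    coinversions n (dropDiagonal X) + X 1 1                   ≤⟨ +-monoʳ-≤ _ (diagonalBound G) ⟩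
    coinversions n (dropDiagonal X) + (diagCoinv n X + 1)     ≡⟨ +-assoc (coinversions n (dropDiagonal X)) _ _ ⟨
    coinversions n (dropDiagonal X) + diagCoinv n X + 1       ≡⟨ cong (_+ 1) (coinv-peelDiagonal n X) ⟨
    coinversions (suc n) X + 1                                ∎)
  where open ≤-Reasoning

T : ℕ → ℕ
T zero    = 0
T (suc k) = T k + suc k

-- Upper bound: every first-column entry is an inversion or a coinversion, not both,
-- so by induction on the size, inversions + coinversions ≤ T n in size n + 1.
invs+coinvs≤T : ∀ n X → IsGog (suc n) X → inversions (suc n) X + coinversions (suc n) X ≤ T n
invs+coinvs≤T zero    X G = z≤n
invs+coinvs≤T (suc m) X G = begin
    inversions (suc (suc m)) X + coinversions (suc (suc m)) X
  ≡⟨ cong₂ _+_ (inv-peelColumnMinor G) (coinv-peelColumnMinor G) ⟩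
    inversions (suc m) Y + colInv (suc m) X + (coinversions (suc m) Y + colCoinv (suc m) X)
  ≡⟨ interchange (inversions (suc m) Y) _ _ _ ⟩
    inversions (suc m) Y + coinversions (suc m) Y + (colInv (suc m) X + colCoinv (suc m) X)
  ≤⟨ +-mono-≤ (invs+coinvs≤T m Y (columnMinor-isGog G)) firstColumn ⟩
    T m + suc m ∎
  where
  open ≤-Reasoning
  Y = columnMinor X
  firstColumn : colInv (suc m) X + colCoinv (suc m) X ≤ suc m
  firstColumn = begin
      colInv (suc m) X + colCoinv (suc m) X
    ≡⟨ Σ₁-+ (suc m) _ _ ⟨
      Σ₁ (suc m) (λ i → δ (X i 1) (X (suc i) 1) + δ (X i 1) (X (suc i) 2))
    ≤⟨ Σ₁-mono (suc m) _ (λ _ → 1) (λ i p q → δ-pair≤1 (X i 1) (rowStrict G (suc i) 1 ≤-refl (s≤s p) (s≤s q))) ⟩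
      Σ₁ (suc m) (λ _ → 1)
    ≡⟨ Σ₁-ones (suc m) ⟩
      suc m ∎

T-grows : ∀ r → T (suc r) ≤ T r → ⊥
T-grows r h = 1+n≰n (≤-trans (s≤s (m≤m+n (T r) r)) (≤-trans (≤-reflexive (sym (+-suc (T r) r))) h))

∸-suc : ∀ {m k} → suc k ≤ m → m ∸ k ≡ suc (m ∸ suc k)
∸-suc {suc m} (s≤s k≤m) = +-∸-assoc 1 k≤m

gapBelow : ∀ {n k x} → k ≤ n → n < k + x → (n ∸ k) + 1 ≤ x
gapBelow {n} {k} {x} k≤n n<k+x = +-cancelʳ-≤ k _ x (begin
    n ∸ k + 1 + k   ≡⟨ xy∙z≈xz∙y (n ∸ k) 1 k ⟩
    n ∸ k + k + 1   ≡⟨ cong (_+ 1) (m∸n+n≡m k≤n) ⟩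
    n + 1           ≡⟨ +-comm n 1 ⟩
    suc n           ≤⟨ n<k+x ⟩
    k + x           ≡⟨ +-comm k x ⟩
    x + k           ∎)
  where open ≤-Reasoning

trade : ∀ {u v x d N} → u + N ≤ v + x → d + x ≤ N → u + d ≤ v
trade {u} {v} {x} {d} {N} h g = +-cancelʳ-≤ x (u + d) v (begin
    u + d + x    ≡⟨ +-assoc u d x ⟩
    u + (d + x)  ≤⟨ +-monoʳ-≤ u g ⟩
    u + N        ≤⟨ h ⟩
    v + x        ∎)
  where open ≤-Reasoning

Dichotomy : ℕ → Array → Set
Dichotomy n X = ∀ k → T (suc k) ≤ inversions n X ⊎ T (n ∸ 1 ∸ k) ≤ coinversions n X

-- By induction on the size: if k + X 1 1 is small, the first column carries more than
-- k inversions and the column minor is used; otherwise the diagonal carries many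
-- coinversions and the diagonal minor is used.
dichotomy : ∀ n X → IsGog (suc n) X → Dichotomy (suc n) X
dichotomy zero    X G k = inj₂ (≤-reflexive (cong T (0∸n≡0 k)))
dichotomy (suc m) X G k with k + X 1 1 ≤? suc m
... | yes small = viaColumn k (trade (proj₁ (columnPeel G)) (s≤s small))
  where
  Y = columnMinor X
  viaColumn : ∀ k → inversions (suc m) Y + suc k ≤ inversions (suc (suc m)) X →
    T (suc k) ≤ inversions (suc (suc m)) X ⊎ T (suc m ∸ k) ≤ coinversions (suc (suc m)) X
  viaColumn zero    many = inj₁ (m+n≤o⇒n≤o _ many)
  viaColumn (suc k) many with dichotomy m Y (columnMinor-isGog G) k
  ... | inj₁ inv≥   = inj₁ (≤-trans (+-monoˡ-≤ (suc (suc k)) inv≥) many)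
  ... | inj₂ coinv≥ = inj₂ (≤-trans coinv≥ (proj₂ (columnPeel G)))
... | no big with dichotomy m (dropDiagonal X) (dropDiagonal-isGog G) k
...   | inj₁ inv≥   = inj₁ (≤-trans inv≥ (proj₁ (diagonalPeel G)))
...   | inj₂ coinv≥ with k ≤? m
...     | no k>m rewrite m≤n⇒m∸n≡0 (≰⇒> k>m) = inj₂ z≤n
...     | yes k≤m rewrite +-∸-assoc 1 k≤m =
          inj₂ (≤-trans (+-monoˡ-≤ (suc (m ∸ k)) coinv≥) (trade (proj₂ (diagonalPeel G)) gap))
  where
  gap : suc (m ∸ k) + 1 ≤ X 1 1
  gap = subst (λ d → d + 1 ≤ X 1 1) (+-∸-assoc 1 k≤m) (gapBelow (m≤n⇒m≤1+n k≤m) (≰⇒> big))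

-- From a dichotomy, walking k upwards from 0 finds a corner weakly below (I, C).
cornerBelow : ∀ n I C → (∀ k → T (suc k) ≤ I ⊎ T (n ∸ k) ≤ C) →
  ∃[ k ] (k ≤ n × T k ≤ I × T (n ∸ k) ≤ C)
cornerBelow n I C dich = search n 0 (+-identityʳ n) z≤n
  where
  search : ∀ d k → d + k ≡ n → T k ≤ I → ∃[ k ] (k ≤ n × T k ≤ I × T (n ∸ k) ≤ C)
  search d k d+k≡n Tk≤I with dich k
  ... | inj₂ C≥ = k , m+n≤o⇒n≤o d (≤-reflexive d+k≡n) , Tk≤I , C≥
  search zero    k k≡n Tk≤I | inj₁ _ =
    k , ≤-reflexive k≡n , Tk≤I , ≤-trans (≤-reflexive (cong T (trans (cong (_∸ k) (sym k≡n)) (n∸n≡0 k)))) z≤n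
  search (suc d) k d+k<n Tk≤I | inj₁ I≥ = search d (suc k) (trans (+-suc d k) d+k<n) I≥

belowCorner : ∀ {m k W} → IsGog (suc m) W → k ≤ m →
  inversions (suc m) W ≤ T k → coinversions (suc m) W ≤ T (m ∸ k) →
  inversions (suc m) W ≡ T k × coinversions (suc m) W ≡ T (m ∸ k)
belowCorner {m} {k} {W} G k≤m inv≤ coinv≤ = invExact k k≤m inv≤ coinvExact , coinvExact
  where
  -- The dichotomy at k rules out T (k+1) inversions, so the coinversions reach T (m−k).
  coinvExact : coinversions (suc m) W ≡ T (m ∸ k)
  coinvExact with dichotomy m W G k
  ... | inj₁ inv≥   = ⊥-elim (T-grows k (≤-trans inv≥ inv≤))
  ... | inj₂ coinv≥ = ≤-antisym coinv≤ coinv≥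
  -- The dichotomy at k−1 rules out T (m−k+1) coinversions, so the inversions reach T k.
  invExact : ∀ k → k ≤ m → inversions (suc m) W ≤ T k → coinversions (suc m) W ≡ T (m ∸ k) →
             inversions (suc m) W ≡ T k
  invExact zero    _   inv≤ _     = n≤0⇒n≡0 inv≤
  invExact (suc k) k<m inv≤ exact with dichotomy m W G k
  ... | inj₁ inv≥   = ≤-antisym inv≤ inv≥
  ... | inj₂ coinv≥ = ⊥-elim (T-grows (m ∸ suc k)
        (≤-trans (≤-reflexive (cong T (sym (∸-suc k<m)))) (≤-trans coinv≥ (≤-reflexive exact))))

step-∸ : ∀ n i → Step (n ∸ i) (n ∸ suc i)
step-∸ n i = ∸-monoʳ-≤ n (n≤1+n i) , below n i
  where
  below : ∀ n i → n ∸ i ≤ suc (n ∸ suc i)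
  below zero    i       = ≤-trans (≤-reflexive (0∸n≡0 i)) z≤n
  below (suc n) zero    = ≤-refl
  below (suc n) (suc i) = below n i

step-suc : ∀ {a b} → Step a b → Step (suc a) (suc b)
step-suc (b≤a , a≤1+b) = s≤s b≤a , s≤s a≤1+b

step-monus : ∀ {a b} d → Step a b → Step (a ∸ d) (b ∸ d)
step-monus {a} {b} d (b≤a , a≤1+b) = ∸-monoˡ-≤ d b≤a , ≤-trans (∸-monoˡ-≤ d a≤1+b) (suc-monus b d)
  where
  suc-monus : ∀ b d → suc b ∸ d ≤ suc (b ∸ d)
  suc-monus b       zero    = ≤-refl
  suc-monus zero    (suc d) = ≤-trans (≤-reflexive (0∸n≡0 d)) z≤n
  suc-monus (suc b) (suc d) = suc-monus b d

step-⊓ : ∀ {a b} s → Step a b → Step (s ⊓ a) (s ⊓ b)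
step-⊓ {a} {b} s (b≤a , a≤1+b) = ⊓-monoʳ-≤ s b≤a , ≤-trans (⊓-monoʳ-≤ s a≤1+b) (⊓-suc s b)
  where
  ⊓-suc : ∀ s b → s ⊓ suc b ≤ suc (s ⊓ b)
  ⊓-suc zero    b = z≤n
  ⊓-suc (suc s) b = s≤s (⊓-monoˡ-≤ b (n≤1+n s))

-- For k = 0 its diagonal is constant n; for k > 0 it is E (n−1) (k−1) + 1 with a
-- staircase first column in front.
E : ℕ → ℕ → Array
E n k i j = j + ((n ∸ i) ⊓ ((j + (n ∸ i)) ∸ suc k))

E-isGog : ∀ n k → IsGog n (E n k)
E-isGog n k = record
  { top       = λ j p q → trans (cong (λ r → j + (r ⊓ ((j + r) ∸ suc k))) (n∸n≡0 n)) (+-identityʳ j)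
  ; positive  = λ i j p q r → ≤-trans p (m≤m+n j _)
  ; rowStrict = λ i j p q r → s≤s (+-monoʳ-≤ j (⊓-monoʳ-≤ (n ∸ i)
                  (∸-monoˡ-≤ (suc k) (n≤1+n (j + (n ∸ i))))))
  ; interlL   = λ i j p q r → +-monoʳ-≤ j (⊓-mono-≤ (∸-monoʳ-≤ n (n≤1+n i))
                  (∸-monoˡ-≤ (suc k) (+-monoʳ-≤ j (∸-monoʳ-≤ n (n≤1+n i)))))
  ; interlR   = λ i j p q r → interlR′ i j r
  }
  where
  suc-⊓ : ∀ d t → suc d ⊓ t ≤ suc (d ⊓ t)
  suc-⊓ d zero    = z≤n
  suc-⊓ d (suc t) = s≤s (⊓-monoʳ-≤ d (n≤1+n t))
  interlR′ : ∀ i j → i < n → E n k i j ≤ E n k (suc i) (suc j)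
  interlR′ i j i<n rewrite ∸-suc i<n = ≤-trans (+-monoʳ-≤ j (suc-⊓ (n ∸ suc i) _))
    (≤-reflexive (trans (+-suc j _)
      (cong (λ r → suc (j + ((n ∸ suc i) ⊓ (r ∸ suc k)))) (+-suc j (n ∸ suc i)))))

E-column : ∀ n k i → E n k i 1 ≡ suc ((n ∸ i) ∸ k)
E-column n k i = cong suc (m≥n⇒m⊓n≡n (m∸n≤m (n ∸ i) k))

E-bottom : ∀ n k → k < n → E n k 1 1 ≡ n ∸ k
E-bottom (suc n) k (s≤s k≤n) = trans (E-column (suc n) k 1) (sym (+-∸-assoc 1 k≤n))

E₀-diagonal : ∀ n i → 1 ≤ i → i ≤ n → E n 0 i i ≡ n
E₀-diagonal n i p q = trans (cong (i +_) (m≤n⇒m⊓n≡m short)) (m+[n∸m]≡n q)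
  where
  short : n ∸ i ≤ (i + (n ∸ i)) ∸ 1
  short rewrite m+[n∸m]≡n q = ∸-monoʳ-≤ n p

E₀-subdiagonal : ∀ n i → suc i ≤ n → E n 0 (suc i) i < n
E₀-subdiagonal n i q =
  ≤-trans (s≤s (+-monoʳ-≤ i (m⊓n≤m (n ∸ suc i) _))) (≤-reflexive (m+[n∸m]≡n q))

E-lastColumn : ∀ n i → 1 ≤ i → i ≤ n → E n (n ∸ 1) i 1 ≡ 1
E-lastColumn n i p q = trans (E-column n (n ∸ 1) i) (cong suc (m≤n⇒m∸n≡0 (∸-monoʳ-≤ n p)))

-- E (n+1) k has T k inversions and T (n−k) coinversions: for k = 0 by peeling the
-- diagonal (all coinversions), for k > 0 by peeling the staircase first column.
E-counts : ∀ n k → k ≤ n →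
  inversions (suc n) (E (suc n) k) ≡ T k × coinversions (suc n) (E (suc n) k) ≡ T (n ∸ k)
E-counts zero    zero    _ = refl , refl
E-counts (suc n) zero    _ =
  trans (inv-peelDiagonal (suc n) (E N 0)) (cong₂ _+_ (proj₁ (E-counts n 0 z≤n)) noDiagInv) ,
  trans (coinv-peelDiagonal (suc n) (E N 0)) (cong₂ _+_ (proj₂ (E-counts n 0 z≤n)) allDiagCoinv)
  where
  N = suc (suc n)
  noDiagInv : diagInv (suc n) (E N 0) ≡ 0
  noDiagInv = Σ₁-zero (suc n) _ (λ i p q → trans
    (cong (λ x → δ x (E N 0 (suc i) i)) (E₀-diagonal N i p (m≤n⇒m≤1+n q)))
    (δ-≢ (>⇒≢ (E₀-subdiagonal N i (s≤s q)))))
  allDiagCoinv : diagCoinv (suc n) (E N 0) ≡ suc n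
  allDiagCoinv = Σ₁-one (suc n) _ (λ i p q → trans
    (cong₂ δ (E₀-diagonal N i p (m≤n⇒m≤1+n q)) (E₀-diagonal N (suc i) (s≤s z≤n) (s≤s q)))
    (δ-refl N))
E-counts (suc n) (suc k) (s≤s k≤n) =
  trans (inv-peelColumn (suc n) (E N (suc k)))
    (cong₂ _+_ (trans (inv-suc (suc n) (E (suc n) k)) (proj₁ (E-counts n k k≤n))) staircase) ,
  trans (coinv-peelColumn (suc n) (E N (suc k)))
    (trans (cong₂ _+_ (trans (coinv-suc (suc n) (E (suc n) k)) (proj₂ (E-counts n k k≤n))) noColCoinv)
           (+-identityʳ _))
  where
  N = suc (suc n)
  u : ℕ → ℕ
  u i = suc ((N ∸ i) ∸ suc k)
  staircase : colInv (suc n) (E N (suc k)) ≡ suc k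
  staircase = +-cancelʳ-≡ (suc (n ∸ k)) _ (suc k) (begin
      colInv (suc n) (E N (suc k)) + suc (n ∸ k)
    ≡⟨ cong (_+ suc (n ∸ k)) (Σ₁-cong (suc n) _ _ (λ i _ _ →
         cong₂ δ (E-column N (suc k) i) (E-column N (suc k) (suc i)))) ⟩
      flats (suc n) u + u 1
    ≡⟨ descentFlats (suc n) u (λ i _ _ → step-suc (step-monus (suc k) (step-∸ N i))) ⟨
      suc n + suc ((n ∸ n) ∸ suc k)
    ≡⟨ cong (λ r → suc n + suc (r ∸ suc k)) (n∸n≡0 n) ⟩
      suc n + 1
    ≡⟨ cong (λ r → suc r + 1) (m∸n+n≡m k≤n) ⟨
      suc (n ∸ k + k) + 1
    ≡⟨ rearrange (n ∸ k) k ⟩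
      suc k + suc (n ∸ k)
    ∎)
    where
    open ≡-Reasoning
    rearrange : ∀ r k → suc (r + k) + 1 ≡ suc k + suc r
    rearrange = solve-∀
  noColCoinv : colCoinv (suc n) (E N (suc k)) ≡ 0
  noColCoinv = Σ₁-zero (suc n) _ (λ i p q → δ-≢ (<⇒≢ (begin-strict
      E N (suc k) i 1                    ≡⟨ E-column N (suc k) i ⟩
      suc ((N ∸ i) ∸ suc k)              ≡⟨ cong (λ r → suc (r ∸ suc k)) (∸-suc (s≤s q)) ⟩
      suc ((suc n ∸ i) ∸ k)              ≡⟨ E-column (suc n) k i ⟨
      E (suc n) k i 1                    <⟨ n<1+n _ ⟩
      suc (E (suc n) k i 1)              ∎)))
    where open ≤-Reasoning

triangular-cancel : ∀ u r → u + suc (suc r) ≤ T (suc r) → suc u ≤ T r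
triangular-cancel u r h = +-cancelʳ-≤ (suc r) (suc u) (T r) (≤-trans (≤-reflexive (sym (+-suc u (suc r)))) h)

-- At a corner, the bottom entry is forced: k + X 1 1 = n. A smaller bottom entry would
-- push the column minor strictly below a corner, a larger one the diagonal minor.
cornerBottom : ∀ {m k X} → IsGog (suc (suc m)) X → k ≤ suc m →
  inversions (suc (suc m)) X ≡ T k → coinversions (suc (suc m)) X ≡ T (suc m ∸ k) →
  k + X 1 1 ≡ suc (suc m)
cornerBottom {m} {k} {X} G k≤ invs coinvs with <-cmp (k + X 1 1) (suc (suc m))
... | tri≈ _ bottom _ = bottom
... | tri< low _ _ = ⊥-elim (columnTooRich k k≤ (≤-trans (proj₂ (columnPeel G)) (≤-reflexive coinvs))
                              (subst (inversions (suc m) Y + suc k ≤_) invs (trade (proj₁ (columnPeel G)) low)))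
  where
  Y = columnMinor X
  columnTooRich : ∀ k → k ≤ suc m → coinversions (suc m) Y ≤ T (suc m ∸ k) →
                  inversions (suc m) Y + suc k ≤ T k → ⊥
  columnTooRich zero    _   _       rich = 1+n≰n (m+n≤o⇒n≤o _ rich)
  columnTooRich (suc k) k<  coinvY≤ rich = 1+n≰n (≤-trans fewer (≤-reflexive (sym exact)))
    where
    fewer = triangular-cancel _ k rich
    exact = proj₁ (belowCorner (columnMinor-isGog G) (≤-pred k<) (<⇒≤ fewer) coinvY≤)
... | tri> _ _ high with k ≤? m
...   | yes k≤m = ⊥-elim (1+n≰n (≤-trans fewer (≤-reflexive (sym exact))))
  where
  r = m ∸ k
  Z = dropDiagonal X
  rich : coinversions (suc m) Z + suc (suc r) ≤ T (suc r)
  rich = trade (subst (λ C → coinversions (suc m) Z + X 1 1 ≤ T C + 1) (+-∸-assoc 1 k≤m)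
                  (subst (λ C → coinversions (suc m) Z + X 1 1 ≤ C + 1) coinvs (proj₂ (diagonalPeel G))))
               (subst (λ d → d + 1 ≤ X 1 1) (+-∸-assoc 2 k≤m) (gapBelow (m≤n⇒m≤1+n k≤) high))
  fewer = triangular-cancel _ r rich
  exact = proj₂ (belowCorner (dropDiagonal-isGog G) k≤m
                   (≤-trans (proj₁ (diagonalPeel G)) (≤-reflexive invs)) (<⇒≤ fewer))
...   | no k≰m = ⊥-elim (1+n≰n (begin-strict
    1                                        <⟨ two≤x ⟩
    X 1 1                                    ≤⟨ m≤n+m (X 1 1) _ ⟩
    coinversions (suc m) (dropDiagonal X) + X 1 1 ≤⟨ proj₂ (diagonalPeel G) ⟩
    coinversions (suc (suc m)) X + 1         ≡⟨ cong (_+ 1) (trans coinvs (cong T (m≤n⇒m∸n≡0 (≰⇒> k≰m)))) ⟩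
    1                                        ∎))
  where
  open ≤-Reasoning
  two≤x : 2 ≤ X 1 1
  two≤x = +-cancelˡ-≤ k 2 (X 1 1) (≤-trans (≤-trans (≤-reflexive (+-comm k 2)) (+-monoʳ-≤ 2 k≤)) high)

dropDiagonal-atCorner : ∀ {m k X} → IsGog (suc (suc m)) X → k ≤ m →
  inversions (suc (suc m)) X ≡ T k → coinversions (suc (suc m)) X ≡ T (suc m ∸ k) →
  k + X 1 1 ≡ suc (suc m) →
  inversions (suc m) (dropDiagonal X) ≡ T k × coinversions (suc m) (dropDiagonal X) ≡ T (m ∸ k)
dropDiagonal-atCorner {m} {k} {X} G k≤m invs coinvs bottom =
  belowCorner (dropDiagonal-isGog G) k≤m (≤-trans (proj₁ (diagonalPeel G)) (≤-reflexive invs))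
    (+-cancelʳ-≤ (suc (m ∸ k)) _ _ (trade peel gap))
  where
  peel : coinversions (suc m) (dropDiagonal X) + X 1 1 ≤ T (suc (m ∸ k)) + 1
  peel = subst (λ C → coinversions (suc m) (dropDiagonal X) + X 1 1 ≤ C + 1)
           (trans coinvs (cong T (+-∸-assoc 1 k≤m))) (proj₂ (diagonalPeel G))
  gap : suc (m ∸ k) + 1 ≤ X 1 1
  gap = subst (λ d → d + 1 ≤ X 1 1) (+-∸-assoc 1 k≤m)
          (gapBelow (m≤n⇒m≤1+n k≤m) (≤-reflexive (sym bottom)))

columnMinor-atCorner : ∀ {m k X} → IsGog (suc (suc m)) X → k ≤ m →
  inversions (suc (suc m)) X ≡ T (suc k) → coinversions (suc (suc m)) X ≡ T (m ∸ k) →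
  suc k + X 1 1 ≡ suc (suc m) →
  inversions (suc m) (columnMinor X) ≡ T k × coinversions (suc m) (columnMinor X) ≡ T (m ∸ k)
columnMinor-atCorner {m} {k} {X} G k≤m invs coinvs bottom =
  belowCorner (columnMinor-isGog G) k≤m
    (+-cancelʳ-≤ (suc k) _ _ (trade (subst (λ I → inversions (suc m) (columnMinor X) + suc (suc m) ≤ I + X 1 1)
                                            invs (proj₁ (columnPeel G)))
                                     (≤-reflexive bottom)))
    (≤-trans (proj₂ (columnPeel G)) (≤-reflexive coinvs))

sameTriangle-viaDiagonal : ∀ n A X → SameTriangle n (dropDiagonal A) (dropDiagonal X) →
  (∀ i → 1 ≤ i → i ≤ suc n → A i i ≡ X i i) → SameTriangle (suc n) A X
sameTriangle-viaDiagonal n A X rest diagonal i j p q r with m≤n⇒m<n∨m≡n q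
sameTriangle-viaDiagonal n A X rest diagonal (suc i) j p q r | inj₁ (s≤s j≤i) = rest i j p j≤i (≤-pred r)
sameTriangle-viaDiagonal n A X rest diagonal i .i p q r | inj₂ refl = diagonal i p r

sameTriangle-viaColumn : ∀ n A X → SameTriangle n (dropColumn A) (dropColumn X) →
  (∀ i → 1 ≤ i → i ≤ suc n → A i 1 ≡ X i 1) → SameTriangle (suc n) A X
sameTriangle-viaColumn n A X rest column i (suc zero)    p q r = column i q r
sameTriangle-viaColumn n A X rest column (suc i) (suc (suc j)) p (s≤s q) r = rest i (suc j) (s≤s z≤n) q (≤-pred r)

-- Induction on the size:
-- for k = 0 the diagonal is forced to be constant n; for k > 0 the first column is
-- forced (bottom entry, then the diagonal minor or all ones) and the column minor is
-- extremal one size down.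
E-unique : ∀ n k → k ≤ n → ∀ X → IsGog (suc n) X →
  inversions (suc n) X ≡ T k → coinversions (suc n) X ≡ T (n ∸ k) → SameTriangle (suc n) (E (suc n) k) X
E-unique zero zero _ X G _ _ (suc zero) (suc zero) _ _ _ = sym (top G 1 ≤-refl ≤-refl)
E-unique zero zero _ X G _ _ (suc zero) (suc (suc j)) _ (s≤s ()) _
E-unique zero zero _ X G _ _ (suc (suc i)) j _ _ (s≤s ())
E-unique (suc m) zero _ X G invs coinvs =
  sameTriangle-viaDiagonal (suc m) (E N 0) X
    (E-unique m 0 z≤n (dropDiagonal X) (dropDiagonal-isGog G) (proj₁ minor) (proj₂ minor))
    (λ i p q → trans (E₀-diagonal N i p q) (sym (≤-antisym (diagonal≤size G i p q) (atLeastN i p q))))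
  where
  N = suc (suc m)
  bottom = cornerBottom G z≤n invs coinvs
  minor = dropDiagonal-atCorner G z≤n invs coinvs bottom
  atLeastN : ∀ i → 1 ≤ i → i ≤ N → N ≤ X i i
  atLeastN (suc i) _ q = ≤-trans (≤-reflexive (sym bottom)) (diagonal-mono G 1 i ≤-refl q)
E-unique (suc m) (suc k) (s≤s k≤m) X G invs coinvs =
  sameTriangle-viaColumn (suc m) (E N (suc k)) X
    (λ i j p q r → trans (cong suc (E-unique m k k≤m (columnMinor X) (columnMinor-isGog G)
                                      (proj₁ minor) (proj₂ minor) i j p q r))
                         (sym (dropColumn-as-minor G i j p q r)))
    column
  where
  N = suc (suc m)
  bottom = cornerBottom G (s≤s k≤m) invs coinvs
  minor = columnMinor-atCorner G k≤m invs coinvs bottom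
  column : ∀ i → 1 ≤ i → i ≤ N → E N (suc k) i 1 ≡ X i 1
  column (suc zero) _ _ = trans (E-bottom N (suc k) (s≤s (s≤s k≤m)))
    (sym (trans (sym (m+n∸m≡n (suc k) (X 1 1))) (cong (_∸ suc k) bottom)))
  column (suc (suc i)) _ q with suc k ≤? m
  ... | yes k<m = E-unique m (suc k) k<m (dropDiagonal X) (dropDiagonal-isGog G) (proj₁ below) (proj₂ below)
                    (suc i) 1 (s≤s z≤n) (s≤s z≤n) (≤-pred q)
    where below = dropDiagonal-atCorner G k<m invs coinvs bottom
  ... | no k≮m = trans (subst (λ t → E N (suc t) (suc (suc i)) 1 ≡ 1) (sym k≡m)
                                (E-lastColumn N (suc (suc i)) (s≤s z≤n) q))
                         (sym (≤-antisym (≤-trans (column-mono G 1 (suc i) ≤-refl q) (≤-reflexive x≡1))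
                                         (positive G (suc (suc i)) 1 ≤-refl (s≤s z≤n) q)))
    where
    -- k = m: the bottom entry is 1, so the whole first column of X is 1.
    k≡m : k ≡ m
    k≡m = ≤-antisym k≤m (≤-pred (≰⇒> k≮m))
    x≡1 : X 1 1 ≡ 1
    x≡1 = +-cancelˡ-≡ (suc k) (X 1 1) 1
            (trans bottom (sym (trans (+-comm (suc k) 1) (cong (λ t → suc (suc t)) k≡m))))

prependColumn : Array → (ℕ → ℕ) → Array
prependColumn Y x i zero          = x i
prependColumn Y x i (suc zero)    = x i
prependColumn Y x i (suc (suc j)) = suc (Y (pred i) (suc j))

record ColumnFits (m : ℕ) (Y : Array) (x : ℕ → ℕ) : Set where
  field
    ends      : x (suc m) ≡ 1
    positive  : ∀ i → 1 ≤ i → i ≤ suc m → 1 ≤ x i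
    descends  : ∀ i → 1 ≤ i → i ≤ m → x (suc i) ≤ x i
    fitsBelow : ∀ i → 1 ≤ i → i ≤ m → x i ≤ Y i 1

prependColumn-isGog : ∀ m Y x → IsGog m Y → ColumnFits m Y x → IsGog (suc m) (prependColumn Y x)
prependColumn-isGog m Y x G C = record
  { top = top′ ; positive = positive′ ; rowStrict = rowStrict′ ; interlL = interlL′ ; interlR = interlR′ }
  where
  module C = ColumnFits C
  X = prependColumn Y x
  top′ : ∀ j → 1 ≤ j → j ≤ suc m → X (suc m) j ≡ j
  top′ (suc zero)    _ _ = C.ends
  top′ (suc (suc j)) _ q = cong suc (top G (suc j) (s≤s z≤n) (≤-pred q))
  positive′ : ∀ i j → 1 ≤ j → j ≤ i → i ≤ suc m → 1 ≤ X i j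
  positive′ i (suc zero)    _ q r = C.positive i q r
  positive′ i (suc (suc j)) _ _ _ = s≤s z≤n
  rowStrict′ : ∀ i j → 1 ≤ j → j < i → i ≤ suc m → X i j < X i (suc j)
  rowStrict′ (suc i) (suc zero)    _ (s≤s q) r =
    s≤s (≤-trans (C.descends i q (≤-pred r)) (C.fitsBelow i q (≤-pred r)))
  rowStrict′ (suc i) (suc (suc j)) _ (s≤s q) r = s≤s (rowStrict G i (suc j) (s≤s z≤n) q (≤-pred r))
  interlL′ : ∀ i j → 1 ≤ j → j ≤ i → i < suc m → X (suc i) j ≤ X i j
  interlL′ i       (suc zero)    _ q       r = C.descends i q (≤-pred r)
  interlL′ (suc i) (suc (suc j)) _ (s≤s q) r = s≤s (interlL G i (suc j) (s≤s z≤n) q (≤-pred r))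
  interlR′ : ∀ i j → 1 ≤ j → j ≤ i → i < suc m → X i j ≤ X (suc i) (suc j)
  interlR′ i       (suc zero)    _ q       r = m≤n⇒m≤1+n (C.fitsBelow i q (≤-pred r))
  interlR′ (suc i) (suc (suc j)) _ (s≤s q) r = s≤s (interlR G i (suc j) (s≤s z≤n) q (≤-pred r))

dropColumn-prependColumn : ∀ m Y x → SameTriangle m (dropColumn (prependColumn Y x)) (λ i j → suc (Y i j))
dropColumn-prependColumn m Y x i (suc j) _ _ _ = refl

prependColumn-inv : ∀ m Y x →
  inversions (suc m) (prependColumn Y x) ≡ inversions m Y + flats m x
prependColumn-inv m Y x = trans (inv-peelColumn m (prependColumn Y x))
  (cong (_+ flats m x) (trans (inv-cong m _ _ (dropColumn-prependColumn m Y x)) (inv-suc m Y)))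

prependColumn-coinv : ∀ m Y x → ColumnFits m Y x →
  coinversions (suc m) (prependColumn Y x) ≡ coinversions m Y
prependColumn-coinv m Y x C = trans (coinv-peelColumn m (prependColumn Y x))
  (trans (cong₂ _+_ (trans (coinv-cong m _ _ (dropColumn-prependColumn m Y x)) (coinv-suc m Y))
                    (Σ₁-zero m _ (λ i p q → δ-≢ (<⇒≢ (s≤s (ColumnFits.fitsBelow C i p q))))))
         (+-identityʳ _))

onDiagonal : ℕ → ℕ → ℕ → ℕ → ℕ
onDiagonal zero    j       u v = u
onDiagonal (suc i) zero    u v = v
onDiagonal (suc i) (suc j) u v = onDiagonal i j u v

onDiagonal-≤ : ∀ i j u v → i ≤ j → onDiagonal i j u v ≡ u
onDiagonal-≤ zero    j       u v _       = refl
onDiagonal-≤ (suc i) (suc j) u v (s≤s p) = onDiagonal-≤ i j u v p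

onDiagonal-> : ∀ i j u v → j < i → onDiagonal i j u v ≡ v
onDiagonal-> (suc i) zero    u v _       = refl
onDiagonal-> (suc i) (suc j) u v (s≤s p) = onDiagonal-> i j u v p

appendDiagonal : Array → (ℕ → ℕ) → Array
appendDiagonal Z d i j = onDiagonal i j (d i) (Z (pred i) j)

record DiagonalFits (m : ℕ) (Z : Array) (d : ℕ → ℕ) : Set where
  field
    ends      : d (suc m) ≡ suc m
    positive  : ∀ i → 1 ≤ i → i ≤ suc m → 1 ≤ d i
    ascends   : ∀ i → 1 ≤ i → i ≤ m → d i ≤ d (suc i)
    fitsAbove : ∀ i → 1 ≤ i → i ≤ m → Z i i < d i

appendDiagonal-isGog : ∀ m Z d → IsGog m Z → DiagonalFits m Z d → IsGog (suc m) (appendDiagonal Z d)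
appendDiagonal-isGog m Z d G C = record
  { top = top′ ; positive = positive′ ; rowStrict = rowStrict′ ; interlL = interlL′ ; interlR = interlR′ }
  where
  module C = DiagonalFits C
  X = appendDiagonal Z d
  diag : ∀ i → X i i ≡ d i
  diag i = onDiagonal-≤ i i _ _ ≤-refl
  below : ∀ i j → j < i → X i j ≡ Z (pred i) j
  below i j j<i = onDiagonal-> i j _ _ j<i
  top′ : ∀ j → 1 ≤ j → j ≤ suc m → X (suc m) j ≡ j
  top′ j p q with m≤n⇒m<n∨m≡n q
  ... | inj₁ j<1+m = trans (below (suc m) j j<1+m) (top G j p (≤-pred j<1+m))
  ... | inj₂ refl  = trans (diag (suc m)) C.ends
  positive′ : ∀ i j → 1 ≤ j → j ≤ i → i ≤ suc m → 1 ≤ X i j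
  positive′ zero    (suc j) p () r
  positive′ (suc i) j p q r with m≤n⇒m<n∨m≡n q
  ... | inj₁ (s≤s j≤i) = subst (1 ≤_) (sym (below (suc i) j (s≤s j≤i))) (positive G i j p j≤i (≤-pred r))
  ... | inj₂ refl      = subst (1 ≤_) (sym (diag (suc i))) (C.positive (suc i) p r)
  rowStrict′ : ∀ i j → 1 ≤ j → j < i → i ≤ suc m → X i j < X i (suc j)
  rowStrict′ (suc i) j p (s≤s j≤i) r with m≤n⇒m<n∨m≡n j≤i
  ... | inj₁ j<i  = subst₂ _<_ (sym (below (suc i) j (s≤s j≤i))) (sym (below (suc i) (suc j) (s≤s j<i)))
                      (rowStrict G i j p j<i (≤-pred r))
  ... | inj₂ refl = subst₂ _<_ (sym (below (suc j) j ≤-refl)) (sym (diag (suc j)))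
                      (≤-trans (C.fitsAbove j p (≤-pred r)) (C.ascends j p (≤-pred r)))
  interlL′ : ∀ i j → 1 ≤ j → j ≤ i → i < suc m → X (suc i) j ≤ X i j
  interlL′ i j p q r with m≤n⇒m<n∨m≡n q
  interlL′ (suc i) j p q r | inj₁ (s≤s j≤i) =
    subst₂ _≤_ (sym (below (suc (suc i)) j (s≤s q))) (sym (below (suc i) j (s≤s j≤i)))
      (interlL G i j p j≤i (≤-pred r))
  interlL′ i .i p q r | inj₂ refl =
    subst₂ _≤_ (sym (below (suc i) i ≤-refl)) (sym (diag i)) (<⇒≤ (C.fitsAbove i p (≤-pred r)))
  interlR′ : ∀ i j → 1 ≤ j → j ≤ i → i < suc m → X i j ≤ X (suc i) (suc j)
  interlR′ i j p q r with m≤n⇒m<n∨m≡n q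
  interlR′ (suc i) j p q r | inj₁ (s≤s j≤i) =
    subst₂ _≤_ (sym (below (suc i) j (s≤s j≤i))) (sym (below (suc (suc i)) (suc j) (s≤s (s≤s j≤i))))
      (interlR G i j p j≤i (≤-pred r))
  interlR′ i .i p q r | inj₂ refl =
    subst₂ _≤_ (sym (diag i)) (sym (diag (suc i))) (C.ascends i p (≤-pred r))

dropDiagonal-appendDiagonal : ∀ m Z d → SameTriangle m (dropDiagonal (appendDiagonal Z d)) Z
dropDiagonal-appendDiagonal m Z d i j _ j≤i _ = onDiagonal-> (suc i) j _ _ (s≤s j≤i)

appendDiagonal-inv : ∀ m Z d → DiagonalFits m Z d →
  inversions (suc m) (appendDiagonal Z d) ≡ inversions m Z
appendDiagonal-inv m Z d C = trans (inv-peelDiagonal m (appendDiagonal Z d))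
  (trans (cong₂ _+_ (inv-cong m _ _ (dropDiagonal-appendDiagonal m Z d))
           (Σ₁-zero m _ (λ i p q → trans
             (cong₂ δ (onDiagonal-≤ i i _ _ ≤-refl) (onDiagonal-> (suc i) i _ _ ≤-refl))
             (δ-≢ (>⇒≢ (DiagonalFits.fitsAbove C i p q))))))
         (+-identityʳ _))

appendDiagonal-coinv : ∀ m Z d →
  coinversions (suc m) (appendDiagonal Z d) ≡ coinversions m Z + flats m d
appendDiagonal-coinv m Z d = trans (coinv-peelDiagonal m (appendDiagonal Z d))
  (cong₂ _+_ (coinv-cong m _ _ (dropDiagonal-appendDiagonal m Z d))
    (Σ₁-cong m _ _ (λ i p q → cong₂ δ (onDiagonal-≤ i i _ _ ≤-refl) (onDiagonal-≤ (suc i) (suc i) _ _ ≤-refl))))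

Realizable : ℕ → ℕ → ℕ → Set
Realizable n i j = ∃[ X ] (IsGog n X × inversions n X ≡ i × coinversions n X ≡ j)

prependOnes : ∀ {n i j} → Realizable n i j → Realizable (suc n) (i + n) j
prependOnes {n} (Y , G , invs , coinvs) =
  prependColumn Y (λ _ → 1) , prependColumn-isGog n Y _ G fits ,
  trans (prependColumn-inv n Y _) (cong₂ _+_ invs (Σ₁-one n _ (λ _ _ _ → refl))) ,
  trans (prependColumn-coinv n Y _ fits) coinvs
  where
  fits : ColumnFits n Y (λ _ → 1)
  fits = record { ends = refl ; positive = λ _ _ _ → ≤-refl ; descends = λ _ _ _ → ≤-refl
                ; fitsBelow = λ i p q → positive G i 1 ≤-refl p q }

appendTop : ∀ {n i j} → Realizable n i j → Realizable (suc n) i (j + n)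
appendTop {n} (Z , G , invs , coinvs) =
  appendDiagonal Z (λ _ → suc n) , appendDiagonal-isGog n Z _ G fits ,
  trans (appendDiagonal-inv n Z _ fits) invs ,
  trans (appendDiagonal-coinv n Z _) (cong₂ _+_ coinvs (Σ₁-one n _ (λ _ _ _ → δ-refl (suc n))))
  where
  fits : DiagonalFits n Z (λ _ → suc n)
  fits = record { ends = refl ; positive = λ _ _ _ → s≤s z≤n ; ascends = λ _ _ _ → ≤-refl
                ; fitsAbove = λ i p q → s≤s (diagonal≤size G i p q) }

-- The frame construction, for the points that neither gadget reaches. With
-- M = a + c + 1 and K = b + e (so a < M and b ≤ K), start from E (M+K) K, append the
-- diagonal min (M+K+1) (M+b+i) (adding M + b coinversions) and prepend the column
-- min (c+2) (M+2−i) (adding a + K + 1 inversions).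
module Frame (a c b e : ℕ) where
  M K p : ℕ
  M = suc (a + c)
  K = b + e
  p = M + K

  W : Array
  W = E p K

  diagonal : ℕ → ℕ
  diagonal i = suc p ⊓ (M + b + i)

  column : ℕ → ℕ
  column i = suc (suc c) ⊓ suc (suc M ∸ i)

  Yd F : Array
  Yd = appendDiagonal W diagonal
  F  = prependColumn Yd column

  W-counts : inversions p W ≡ T K × coinversions p W ≡ T (a + c)
  W-counts = proj₁ counts , trans (proj₂ counts) (cong T (m+n∸n≡m (a + c) K))
    where counts = E-counts (a + c + K) K (m≤n+m K (a + c))

  diagonal-steps : ∀ i → 1 ≤ i → i ≤ p → Step (diagonal (suc i)) (diagonal i)
  diagonal-steps i _ _ = step-⊓ (suc p)
    (subst (λ t → Step t (M + b + i)) (sym (+-suc (M + b) i)) (n≤1+n _ , ≤-refl))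

  diagonal-flats : flats p diagonal ≡ M + b
  diagonal-flats = +-cancelʳ-≡ (suc p) _ _ (begin
      flats p diagonal + suc p
    ≡⟨ cong (flats p diagonal +_) (m≤n⇒m⊓n≡m (m≤n+m (suc p) (M + b))) ⟨
      flats p diagonal + diagonal (suc p)
    ≡⟨ ascentFlats p diagonal diagonal-steps ⟨
      p + diagonal 1
    ≡⟨ cong (p +_) (m≥n⇒m⊓n≡n (≤-trans (≤-reflexive (+-comm (M + b) 1)) (s≤s (+-monoʳ-≤ M (m≤m+n b e))))) ⟩
      p + (M + b + 1)
    ≡⟨ rearrange p (M + b) ⟩
      M + b + suc p ∎)
    where
    open ≡-Reasoning
    rearrange : ∀ p x → p + (x + 1) ≡ x + suc p
    rearrange = solve-∀

  diagonal-fits : DiagonalFits p W diagonal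
  diagonal-fits = record
    { ends      = m≤n⇒m⊓n≡m (m≤n+m (suc p) (M + b))
    ; positive  = λ i q _ → ⊓-glb (s≤s z≤n) (≤-trans q (m≤n+m i _))
    ; ascends   = λ i q r → proj₁ (diagonal-steps i q r)
    ; fitsAbove = λ i q r → ⊓-glb (s≤s (diagonal≤size (E-isGog p K) i q r)) (belowFrame i r)
    }
    where
    belowFrame : ∀ i → i ≤ p → W i i < M + b + i
    belowFrame i r = begin-strict
      W i i                                     ≤⟨ +-monoʳ-≤ i (m⊓n≤n (p ∸ i) _) ⟩
      i + ((i + (p ∸ i)) ∸ suc K)               ≡⟨ cong (λ t → i + (t ∸ suc K)) (m+[n∸m]≡n r) ⟩
      i + (p ∸ suc K)                           ≡⟨ cong (i +_) (m+n∸n≡m (a + c) K) ⟩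
      i + (a + c)                               <⟨ s≤s (m≤m+n (i + (a + c)) b) ⟩
      suc (i + (a + c) + b)                     ≡⟨ rearrange i (a + c) b ⟩
      M + b + i                                 ∎
      where
      open ≤-Reasoning
      rearrange : ∀ i x b → suc (i + x + b) ≡ suc x + b + i
      rearrange = solve-∀

  W-column : ∀ j → W j 1 ≡ suc (M ∸ j)
  W-column j = trans (E-column p K j) (cong suc (begin
      (M + K ∸ j) ∸ K   ≡⟨ ∸-+-assoc (M + K) j K ⟩
      M + K ∸ (j + K)   ≡⟨ cong₂ _∸_ (+-comm M K) (+-comm j K) ⟩
      K + M ∸ (K + j)   ≡⟨ [m+n]∸[m+o]≡n∸o K M j ⟩
      M ∸ j             ∎))
    where open ≡-Reasoning

  column-steps : ∀ i → 1 ≤ i → i ≤ suc p → Step (column i) (column (suc i))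
  column-steps i _ _ = step-⊓ (suc (suc c)) (step-suc (step-∸ (suc M) i))

  column-ends : column (suc (suc p)) ≡ 1
  column-ends = cong (λ t → suc (suc c) ⊓ suc t) (m≤n⇒m∸n≡0 (≤-trans (m≤m+n M K) (n≤1+n p)))

  column-fits : ColumnFits (suc p) Yd column
  column-fits = record
    { ends      = column-ends
    ; positive  = λ _ _ _ → ⊓-glb (s≤s z≤n) (s≤s z≤n)
    ; descends  = λ i q r → proj₁ (column-steps i q r)
    ; fitsBelow = fitsBelow
    }
    where
    fitsBelow : ∀ i → 1 ≤ i → i ≤ suc p → column i ≤ Yd i 1
    fitsBelow (suc zero)    _ _ = ≤-trans (m⊓n≤m (suc (suc c)) _) (⊓-glb
      (s≤s (s≤s (≤-trans (m≤n+m c a) (m≤m+n (a + c) K))))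
      (≤-trans (s≤s (s≤s (m≤n+m c a))) (≤-trans (≤-reflexive (+-comm 1 M)) (+-monoˡ-≤ 1 (m≤m+n M b)))))
    fitsBelow (suc (suc i)) _ _ = ≤-trans (m⊓n≤n (suc (suc c)) _) (≤-reflexive (sym (W-column (suc i))))

  column-flats : flats (suc p) column ≡ a + suc K
  column-flats = +-cancelʳ-≡ (suc (suc c)) _ _ (begin
      flats (suc p) column + suc (suc c)
    ≡⟨ cong (flats (suc p) column +_) (m≤n⇒m⊓n≡m (s≤s (s≤s (m≤n+m c a)))) ⟨
      flats (suc p) column + column 1
    ≡⟨ descentFlats (suc p) column column-steps ⟨
      suc p + column (suc (suc p))
    ≡⟨ cong (suc p +_) column-ends ⟩
      suc p + 1
    ≡⟨ rearrange a c K ⟩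
      a + suc K + suc (suc c) ∎)
    where
    open ≡-Reasoning
    rearrange : ∀ a c K → suc (suc (a + c) + K) + 1 ≡ a + suc K + suc (suc c)
    rearrange = solve-∀

  F-isGog : IsGog (suc (suc p)) F
  F-isGog = prependColumn-isGog (suc p) Yd column
              (appendDiagonal-isGog p W diagonal (E-isGog p K) diagonal-fits) column-fits

  F-inv : inversions (suc (suc p)) F ≡ T (suc K) + a
  F-inv = begin
      inversions (suc (suc p)) F             ≡⟨ prependColumn-inv (suc p) Yd column ⟩
      inversions (suc p) Yd + flats (suc p) column
        ≡⟨ cong₂ _+_ (trans (appendDiagonal-inv p W diagonal diagonal-fits) (proj₁ W-counts)) column-flats ⟩
      T K + (a + suc K)                      ≡⟨ rearrange (T K) a K ⟩
      T K + suc K + a                        ∎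
    where
    open ≡-Reasoning
    rearrange : ∀ t a K → t + (a + suc K) ≡ t + suc K + a
    rearrange = solve-∀

  F-coinv : coinversions (suc (suc p)) F ≡ T M + b
  F-coinv = begin
      coinversions (suc (suc p)) F           ≡⟨ prependColumn-coinv (suc p) Yd column column-fits ⟩
      coinversions (suc p) Yd                ≡⟨ appendDiagonal-coinv p W diagonal ⟩
      coinversions p W + flats p diagonal    ≡⟨ cong₂ _+_ (proj₂ W-counts) diagonal-flats ⟩
      T (a + c) + (M + b)                    ≡⟨ +-assoc (T (a + c)) M b ⟨
      T M + b                                ∎
    where open ≡-Reasoning

frame : ∀ {M K a b} → a < M → b ≤ K → Realizable (suc (suc (M + K))) (T (suc K) + a) (T M + b)
frame {M} {K} {a} {b} a<M b≤K = framed (m+[n∸m]≡n a<M) (m+[n∸m]≡n b≤K)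
  where
  framed : ∀ {c e M′ K′} → suc (a + c) ≡ M′ → b + e ≡ K′ →
           Realizable (suc (suc (M′ + K′))) (T (suc K′) + a) (T M′ + b)
  framed {c} {e} refl refl = F , F-isGog , F-inv , F-coinv
    where open Frame a c b e

realizable-cong : ∀ {n n′ i i′ j j′} → n ≡ n′ → i ≡ i′ → j ≡ j′ → Realizable n i j → Realizable n′ i′ j′
realizable-cong refl refl refl R = R

viaOnes : ∀ {m i j} → suc m ≤ i → Realizable (suc m) (i ∸ suc m) j → Realizable (suc (suc m)) i j
viaOnes m+1≤i R = realizable-cong refl (m∸n+n≡m m+1≤i) refl (prependOnes R)

viaTop : ∀ {m i j} → suc m ≤ j → Realizable (suc m) i (j ∸ suc m) → Realizable (suc (suc m)) i j
viaTop m+1≤j R = realizable-cong refl refl (m∸n+n≡m m+1≤j) (appendTop R)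

budget-i : ∀ {i j s t} → s ≤ i → i + j ≤ t + s → (i ∸ s) + j ≤ t
budget-i {i} {j} {s} {t} s≤i h =
  subst (_≤ t) (+-∸-comm j s≤i) (m≤n+o⇒m∸n≤o (i + j) s (≤-trans h (≤-reflexive (+-comm t s))))

budget-j : ∀ {i j s t} → s ≤ j → i + j ≤ t + s → i + (j ∸ s) ≤ t
budget-j {i} {j} {s} {t} s≤j h =
  subst (_≤ t) (+-∸-assoc i s≤j) (m≤n+o⇒m∸n≤o (i + j) s (≤-trans h (≤-reflexive (+-comm t s))))

-- Induction on n: if i leaves room for a first
-- column of ones or j for a top diagonal, remove it and recurse; otherwise the point is
-- reached by the frame construction.
realize : ∀ n k i j → k ≤ n → T k ≤ i → T (n ∸ k) ≤ j → i + j ≤ T n → Realizable (suc n) i j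
realize zero zero i j _ _ _ i+j≤0 =
  realizable-cong refl (sym (n≤0⇒n≡0 (m+n≤o⇒m≤o i i+j≤0))) (sym (n≤0⇒n≡0 (m+n≤o⇒n≤o i i+j≤0)))
    (E 1 0 , E-isGog 1 0 , E-counts 0 0 z≤n)
realize (suc m) zero i j _ hi hj hs =
  viaTop (m+n≤o⇒n≤o (T m) hj) (realize m 0 i (j ∸ suc m) z≤n hi (m+n≤o⇒m≤o∸n (T m) hj)
                                 (budget-j (m+n≤o⇒n≤o (T m) hj) hs))
realize (suc m) (suc k) i j (s≤s k≤m) hi hj hs with T k + suc m ≤? i
... | yes roomI = viaOnes (m+n≤o⇒n≤o (T k) roomI)
        (realize m k (i ∸ suc m) j k≤m (m+n≤o⇒m≤o∸n (T k) roomI) hj (budget-i (m+n≤o⇒n≤o (T k) roomI) hs))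
... | no noRoomI with suc k ≤? m
...   | no k≮m = ⊥-elim (noRoomI (subst (λ t → T k + suc t ≤ i) (≤-antisym k≤m (≤-pred (≰⇒> k≮m))) hi))
...   | yes k<m with T (m ∸ suc k) + suc m ≤? j
...     | yes roomJ = viaTop (m+n≤o⇒n≤o _ roomJ)
          (realize m (suc k) i (j ∸ suc m) k<m hi (m+n≤o⇒m≤o∸n _ roomJ) (budget-j (m+n≤o⇒n≤o _ roomJ) hs))
...     | no noRoomJ =
          realizable-cong (cong (λ t → suc (suc t)) (m∸n+n≡m k≤m)) (m+[n∸m]≡n hi) (m+[n∸m]≡n hj) (frame a<M b≤K)
  where
  a = i ∸ T (suc k)
  b = j ∸ T (m ∸ k)
  r = m ∸ suc k
  a<M : a < m ∸ k
  a<M = m+n≤o⇒m≤o∸n (suc a) (≤-pred (+-cancelˡ-≤ (T k) _ _ (begin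
      T k + suc (suc a + k)    ≡⟨ rearrange (T k) a k ⟩
      suc (T (suc k) + a)      ≡⟨ cong suc (m+[n∸m]≡n hi) ⟩
      suc i                    ≤⟨ ≰⇒> noRoomI ⟩
      T k + suc m              ∎)))
    where
    open ≤-Reasoning
    rearrange : ∀ t a k → t + suc (suc a + k) ≡ suc (t + suc k + a)
    rearrange = solve-∀
  b≤K : b ≤ k
  b≤K = +-cancelˡ-≤ (suc r) b k (≤-pred (+-cancelˡ-≤ (T r) _ _ (begin
      T r + suc (suc r + b)    ≡⟨ rearrange (T r) r b ⟩
      suc (T (suc r) + b)      ≡⟨ cong (λ t → suc (T t + b)) (∸-suc k<m) ⟨
      suc (T (m ∸ k) + b)      ≡⟨ cong suc (m+[n∸m]≡n hj) ⟩
      suc j                    ≤⟨ ≰⇒> noRoomJ ⟩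
      T r + suc m              ≡⟨ cong (λ t → T r + suc t) (trans (sym (m∸n+n≡m k<m)) (+-suc r k)) ⟩
      T r + suc (suc r + k)    ∎)))
    where
    open ≤-Reasoning
    rearrange : ∀ t r b → t + suc (suc r + b) ≡ suc (t + suc r + b)
    rearrange = solve-∀

T-double : ∀ k → T k * 2 ≡ k * suc k
T-double zero    = refl
T-double (suc k) = trans (*-distribʳ-+ 2 (T k) (suc k)) (trans (cong (_+ suc k * 2) (T-double k)) (step k))
  where
  step : ∀ k → k * suc k + suc k * 2 ≡ suc k * suc (suc k)
  step = solve-∀

half-triangle : ∀ k → (k * suc k) / 2 ≡ T k
half-triangle k = trans (cong (_/ 2) (sym (T-double k))) (m*n/n≡m (T k) 2)

half-size : ∀ n → (suc n * (suc n ∸ 1)) / 2 ≡ T n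
half-size n = trans (cong (_/ 2) (*-comm (suc n) n)) (half-triangle n)

half-corner : ∀ n k → ((suc n ∸ k ∸ 1) * (suc n ∸ k)) / 2 ≡ T (n ∸ k)
half-corner n k = trans (half-pred (suc n ∸ k))
  (cong T (trans (∸-+-assoc (suc n) k 1) (cong (suc n ∸_) (+-comm k 1))))
  where
  half-pred : ∀ x → ((x ∸ 1) * x) / 2 ≡ T (x ∸ 1)
  half-pred zero    = refl
  half-pred (suc y) = half-triangle y

mainTheorem7 : ∀ n → 1 ≤ n →
    (∀ i j →
      (∃[ X ] (IsGog n X × inversions n X ≡ i × coinversions n X ≡ j)) ⇔ InA n i j)
    ×
    (∀ k → k < n →
      ∃[ X ] ((IsGog n X × inversions n X ≡ (k * suc k) / 2
                × coinversions n X ≡ ((n ∸ k ∸ 1) * (n ∸ k)) / 2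
                × X 1 1 ≡ n ∸ k)
             × (∀ Y → IsGog n Y → inversions n Y ≡ (k * suc k) / 2
                  → coinversions n Y ≡ ((n ∸ k ∸ 1) * (n ∸ k)) / 2
                  → SameTriangle n X Y)))
mainTheorem7 (suc n) _ = (λ i j → mk⇔ necessary sufficient) , corner
  where
  -- Necessity: the dichotomy places (i, j) above some corner, the upper bound caps i + j.
  necessary : ∀ {i j} → Realizable (suc n) i j → InA (suc n) i j
  necessary (X , G , refl , refl) with cornerBelow n _ _ (dichotomy n X G)
  ... | k , k≤n , Tk≤i , Tn-k≤j =
    k , s≤s k≤n , subst (_≤ inversions (suc n) X) (sym (half-triangle k)) Tk≤i ,
    subst (_≤ coinversions (suc n) X) (sym (half-corner n k)) Tn-k≤j ,
    subst (inversions (suc n) X + coinversions (suc n) X ≤_) (sym (half-size n)) (invs+coinvs≤T n X G)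
  sufficient : ∀ {i j} → InA (suc n) i j → Realizable (suc n) i j
  sufficient {i} {j} (k , s≤s k≤n , Tk≤i , Tn-k≤j , i+j≤) =
    realize n k i j k≤n (subst (_≤ i) (half-triangle k) Tk≤i) (subst (_≤ j) (half-corner n k) Tn-k≤j)
      (subst (i + j ≤_) (half-size n) i+j≤)
  corner : ∀ k → k < suc n → _
  corner k (s≤s k≤n) =
    E (suc n) k ,
    (E-isGog (suc n) k , trans (proj₁ counts) (sym (half-triangle k)) ,
     trans (proj₂ counts) (sym (half-corner n k)) , E-bottom (suc n) k (s≤s k≤n)) ,
    (λ Y G invs coinvs → E-unique n k k≤n Y G (trans invs (half-triangle k)) (trans coinvs (half-corner n k)))
    where counts = E-counts n k k≤n
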